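{- Let $(G,M)$ be a square graph, let $R\subseteq E(G)\setminus M$ contain exactly one edge from each square, and let $\mathcal{H}$ be the set of Hamiltonian cycles of $G$ containing $M$. Then $\mathcal{H}\ne\emptyset$, and $\mathcal{D}:=\{H\cap R: H\in\mathcal{H}\}$ is a delta-matroid on ground set $R$.
   Context: A square graph is a pair $(G,M)$ where $G=(V,E)$ is a cubic $2$-edge-connected graph and $M$ is a perfect matching of $G$ such that the edges of $E\setminus M$ form a node-disjoint union of $4$-cycles, called squares. A family $\mathcal{D}\ne\emptyset$ of subsets of a finite set $S$ is a delta-matroid if for all $D_1,D_2\in\mathcal{D}$ and $j\in D_1\triangle D_2$ there exists $k\in D_1\triangle D_2$ (possibly $k=j$, with $\{j,j\}:=\{j\}$) such that $D_1\triangle\{j,k\}\in\mathcal{D}$. -}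

module Defs where

open import Data.Nat using (ℕ; zero; suc)
open import Data.Bool using (Bool; true; false; _∧_; _xor_; if_then_else_)
open import Data.Fin using (Fin; zero; suc)
open import Data.Fin.Subset using (Subset; _∈_; _∉_; _⊆_; _∩_; _∪_; ⁅_⁆; ⊤; _-_; ∣_∣)
open import Data.Vec using (Vec; tabulate; zipWith)
open import Data.Product using (Σ; ∃; ∃-syntax; _×_; _,_)
open import Data.Sum using (_⊎_)
open import Relation.Binary.PropositionalEquality using (_≡_; _≢_)
open import Relation.Nullary using (¬_; does)
open import Data.Fin using (_≟_)
open import Function using (Injective)

record Graph : Set where
  field
    n     : ℕ
    m     : ℕ
    src   : Fin m → Fin n
    tgt   : Fin m → Fin n
    loopless : ∀ e → src e ≢ tgt e

module _ (G : Graph) where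
  open Graph G

  EdgeSet : Set
  EdgeSet = Subset m

  Joins : Fin m → Fin n → Fin n → Set
  Joins e u v = (src e ≡ u × tgt e ≡ v) ⊎ (src e ≡ v × tgt e ≡ u)

  incident : Fin n → EdgeSet
  incident v = tabulate (λ e → does (src e ≟ v) Data.Bool.∨ does (tgt e ≟ v))

  deg : EdgeSet → Fin n → ℕ
  deg F v = ∣ F ∩ incident v ∣

  data Reach (F : EdgeSet) : Fin n → Fin n → Set where
    here : ∀ {u} → Reach F u u
    step : ∀ {u w v} (e : Fin m) → e ∈ F → Joins e u w → Reach F w v → Reach F u v

  ConnectedBy : EdgeSet → Set
  ConnectedBy F = ∀ u v → Reach F u v

  Cubic : Set
  Cubic = ∀ v → deg ⊤ v ≡ 3

  TwoEdgeConnected : Set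
  TwoEdgeConnected = ConnectedBy ⊤ × (∀ e → ConnectedBy (⊤ - e))

  PerfectMatching : EdgeSet → Set
  PerfectMatching M = ∀ v → deg M v ≡ 1

  HamiltonianCycle : EdgeSet → Set
  HamiltonianCycle H = (∀ v → deg H v ≡ 2) × ConnectedBy H

  next4 : Fin 4 → Fin 4
  next4 zero = suc zero
  next4 (suc zero) = suc (suc zero)
  next4 (suc (suc zero)) = suc (suc (suc zero))
  next4 (suc (suc (suc zero))) = zero

  record Square : Set where
    field
      vs : Fin 4 → Fin n
      es : Fin 4 → Fin m
      vs-distinct : Injective _≡_ _≡_ vs
      es-joins : ∀ i → Joins (es i) (vs i) (vs (next4 i))

  record SquareGraph (M : EdgeSet) : Set where
    field
      cubic : Cubic
      twoEdgeConnected : TwoEdgeConnected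
      perfect : PerfectMatching M
      k : ℕ
      square : Fin k → Square
      node-disjoint : ∀ i i' j j' → Square.vs (square i) j ≡ Square.vs (square i') j' → i ≡ i'
      nonM-are-square-edges : ∀ e → (e ∉ M → ∃[ i ] ∃[ j ] Square.es (square i) j ≡ e)
                                   × ((∃[ i ] ∃[ j ] Square.es (square i) j ≡ e) → e ∉ M)

infixl 5 _△_
_△_ : ∀ {s} → Subset s → Subset s → Subset s
_△_ = zipWith _xor_

-- A family D of subsets of Fin s is a delta-matroid on ground set S:
-- all members are subsets of S, D is nonempty, and the symmetric exchange axiom.
-- ({j,k} is ⁅ j ⁆ ∪ ⁅ k ⁆, which is ⁅ j ⁆ when k = j.)
IsDeltaMatroid : ∀ {s} → Subset s → (Subset s → Set) → Set
IsDeltaMatroid {s} S D =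
  (∀ X → D X → X ⊆ S)
  × (∃[ X ] D X)
  × (∀ D₁ D₂ → D D₁ → D D₂ → ∀ j → j ∈ D₁ △ D₂ →
       ∃[ k ] (k ∈ D₁ △ D₂ × D (D₁ △ (⁅ j ⁆ ∪ ⁅ k ⁆))))

module Submission where

-- At every corner of a square, a 2-factor containing M uses exactly one of the two square
-- sides, so in each square it takes one of the two perfect matchings of the 4-cycle: the
-- 2-factors containing M are indexed by a choice s ∈ {0,1}ᵏ, a Hamiltonian cycle is a
-- connected one, and its trace on R is read off s through the one R-edge of each square.
-- Flipping the choice at a square whose corners lie in two components merges them, since an
-- edge of a 2-regular graph is never a bridge. Existence: keep flipping squares straddled by
-- the component of a fixed vertex (2-edge-connectivity provides one) until it is everything.
-- Exchange: if H₁, H₂ differ at the square of j, flip it in H₁; unless that is already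
-- Hamiltonian, it has exactly two components, an edge of H₂ crosses them, and it lies in a
-- square where H₁ and H₂ differ, whose flip reconnects.

open import Defs
open import Data.Nat using (ℕ; zero; suc; _+_; _*_; _≤_; _<_; z≤n; s≤s)
open import Data.Nat.Properties
  using (+-*-semiring; +-commutativeSemigroup; +-mono-≤; +-mono-<-≤; +-mono-≤-<; m≤m+n; n≤0⇒n≡0; ≤-refl; ≤-trans; ≤-reflexive; +-identityʳ; +-suc; suc-injective; <⇒≱; *-identityˡ; *-identityʳ; *-zeroʳ; *-distribˡ-+; *-comm; even≢odd; +-monoʳ-≤)
  renaming (_≟_ to _≟ℕ_)
open import Algebra.Properties.CommutativeSemigroup +-commutativeSemigroup using (x∙yz≈y∙xz)
open import Algebra.Properties.Semiring.Sum +-*-semiring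
  using (sum; sum-cong-≗; sum-replicate-zero; ∑-distrib-+; ∑-comm; *-distribˡ-sum)
open import Data.Bool.Properties using (∧-zeroʳ; ∧-identityʳ; ∨-zeroʳ; ∨-identityʳ; xor-comm; xor-identityʳ; xor-assoc; xor-same; ∨-idem; ¬-not; not-involutive) renaming (_≟_ to _≟ᵇ_)
open import Data.Bool using (Bool; true; false; not; _∧_; _∨_; _xor_; if_then_else_)
open import Data.Fin using (Fin; zero; suc; _≟_)
open import Data.Fin.Patterns using (0F; 1F; 2F; 3F)
open import Data.Fin.Properties using (¬∀⟶∃¬; any?; all?)
open import Data.Fin.Subset.Properties using (_∈?_; p∩q⊆q)
open import Data.Fin.Subset using (Subset; _∈_; _∉_; _⊆_; _∩_; _∪_; _─_; _-_; ⁅_⁆; ⊤; ∣_∣)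
open import Data.Vec using ([]; _∷_; lookup; tabulate)
open import Data.Vec.Properties using ([]=⇒lookup; lookup⇒[]=; lookup-replicate; lookup-zipWith; lookup∘tabulate; tabulate∘lookup; tabulate-cong)
open import Data.Sum using (_⊎_; inj₁; inj₂; [_,_])
open import Data.Product using (∃-syntax; _×_; _,_; proj₁; proj₂)
open import Data.Empty using (⊥-elim)
open import Relation.Nullary using (¬_; Dec; does; yes; no; contradiction)
open import Relation.Nullary.Decidable using (dec-true; dec-false; _×-dec_; ¬?)
open import Relation.Binary.PropositionalEquality using (_≡_; _≢_; refl; sym; trans; cong; cong₂; subst; module ≡-Reasoning)
open import Function using (_∘_; _$_)

does≡true⇒ : ∀ {a} {A : Set a} (d : Dec A) → does d ≡ true → A
does≡true⇒ (yes a) _ = a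

𝟙 : Bool → ℕ
𝟙 true = 1
𝟙 false = 0

does-≟ᵇ-xor : ∀ p a x → does (p ≟ᵇ a) xor x ≡ does (p ≟ᵇ (a xor x))
does-≟ᵇ-xor true true true = refl
does-≟ᵇ-xor true true false = refl
does-≟ᵇ-xor true false true = refl
does-≟ᵇ-xor true false false = refl
does-≟ᵇ-xor false true true = refl
does-≟ᵇ-xor false true false = refl
does-≟ᵇ-xor false false true = refl
does-≟ᵇ-xor false false false = refl

does-≟ᵇ-xor-≢ : ∀ p {a b} → a ≢ b → does (p ≟ᵇ a) xor does (p ≟ᵇ b) ≡ true
does-≟ᵇ-xor-≢ p {a} {b} a≢b rewrite ¬-not a≢b with p | b
... | true | true = refl
... | true | false = refl
... | false | true = refl
... | false | false = refl

∣p∣≡∑𝟙 : ∀ {n} (p : Subset n) → ∣ p ∣ ≡ sum (𝟙 ∘ lookup p)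
∣p∣≡∑𝟙 [] = refl
∣p∣≡∑𝟙 (true ∷ p) = cong suc (∣p∣≡∑𝟙 p)
∣p∣≡∑𝟙 (false ∷ p) = ∣p∣≡∑𝟙 p

sum-zero : ∀ {n} {f : Fin n → ℕ} → (∀ i → f i ≡ 0) → sum f ≡ 0
sum-zero {n} f≡0 = trans (sum-cong-≗ f≡0) (sum-replicate-zero n)

sum≢0⇒∃≢0 : ∀ {n} (f : Fin n → ℕ) → sum f ≢ 0 → ∃[ i ] f i ≢ 0
sum≢0⇒∃≢0 {n} f sum≢0 = ¬∀⟶∃¬ n (λ i → f i ≡ 0) (λ i → f i ≟ℕ 0) (sum≢0 ∘ sum-zero)

sum-mono-≤ : ∀ {n} {f g : Fin n → ℕ} → (∀ i → f i ≤ g i) → sum f ≤ sum g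
sum-mono-≤ {zero} _ = z≤n
sum-mono-≤ {suc _} f≤g = +-mono-≤ (f≤g zero) (sum-mono-≤ (f≤g ∘ suc))

sum-mono-< : ∀ {n} {f g : Fin n → ℕ} → (∀ i → f i ≤ g i) → ∀ a → f a < g a → sum f < sum g
sum-mono-< f≤g zero fa<ga = +-mono-<-≤ fa<ga (sum-mono-≤ (f≤g ∘ suc))
sum-mono-< f≤g (suc a) fa<ga = +-mono-≤-< (f≤g zero) (sum-mono-< (f≤g ∘ suc) a fa<ga)

zeroAt : ∀ {n} → Fin n → (Fin n → ℕ) → Fin n → ℕ
zeroAt a f i = if does (i ≟ a) then 0 else f i

zeroAt-≢ : ∀ {n} {a i : Fin n} (f : Fin n → ℕ) → i ≢ a → zeroAt a f i ≡ f i
zeroAt-≢ {a = a} {i} f i≢a with i ≟ a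
... | yes i≡a = ⊥-elim (i≢a i≡a)
... | no _ = refl

zeroAt-mono-≤ : ∀ {n} (a : Fin n) {f g : Fin n → ℕ} → (∀ i → f i ≤ g i) → ∀ i → zeroAt a f i ≤ zeroAt a g i
zeroAt-mono-≤ a f≤g i with i ≟ a
... | yes _ = z≤n
... | no _ = f≤g i

sum-split : ∀ {n} (f : Fin n → ℕ) (a : Fin n) → sum f ≡ f a + sum (zeroAt a f)
sum-split f zero = refl
sum-split f (suc a) rewrite sum-split (f ∘ suc) a = x∙yz≈y∙xz (f zero) (f (suc a)) _

sum-split₃ : ∀ {n} (f : Fin n → ℕ) {a b c : Fin n} → b ≢ a → c ≢ a → c ≢ b →
  sum f ≡ f a + (f b + (f c + sum (zeroAt c (zeroAt b (zeroAt a f)))))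
sum-split₃ f {a} {b} {c} b≢a c≢a c≢b = begin
  sum f                                                   ≡⟨ sum-split f a ⟩
  f a + sum fa                                            ≡⟨ cong (f a +_) (sum-split fa b) ⟩
  f a + (fa b + sum fab)                                  ≡⟨ cong (λ x → f a + (x + sum fab)) (zeroAt-≢ f b≢a) ⟩
  f a + (f b + sum fab)                                   ≡⟨ cong (λ x → f a + (f b + x)) (sum-split fab c) ⟩
  f a + (f b + (fab c + sum (zeroAt c fab)))              ≡⟨ cong (λ x → f a + (f b + (x + sum (zeroAt c fab)))) (trans (zeroAt-≢ fa c≢b) (zeroAt-≢ f c≢a)) ⟩
  f a + (f b + (f c + sum (zeroAt c fab)))                ∎
  where
  open ≡-Reasoning
  fa = zeroAt a f
  fab = zeroAt b fa

𝟙≤1 : ∀ b → 𝟙 b ≤ 1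
𝟙≤1 true = s≤s z≤n
𝟙≤1 false = z≤n

∑𝟙≤n : ∀ {n} (p : Fin n → Bool) → sum (𝟙 ∘ p) ≤ n
∑𝟙≤n {zero} p = z≤n
∑𝟙≤n {suc n} p = +-mono-≤ (𝟙≤1 (p zero)) (∑𝟙≤n (p ∘ suc))

∑𝟙<n : ∀ {n} (p : Fin n → Bool) a → p a ≡ false → sum (𝟙 ∘ p) < n
∑𝟙<n p zero pa≡false rewrite pa≡false = s≤s (∑𝟙≤n (p ∘ suc))
∑𝟙<n p (suc a) pa≡false = +-mono-≤-< (𝟙≤1 (p zero)) (∑𝟙<n (p ∘ suc) a pa≡false)

Subset-ext : ∀ {n} {p q : Subset n} → (∀ x → lookup p x ≡ lookup q x) → p ≡ q
Subset-ext {p = p} {q} p≗q = trans (sym (tabulate∘lookup p)) (trans (tabulate-cong p≗q) (tabulate∘lookup q))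

∉⇒lookup≡false : ∀ {n} {p : Subset n} {x} → x ∉ p → lookup p x ≡ false
∉⇒lookup≡false {p = p} {x} x∉p with lookup p x in p[x]
... | true = ⊥-elim (x∉p (lookup⇒[]= x p p[x]))
... | false = refl

lookup-⁅⁆ : ∀ {n} (y x : Fin n) → lookup ⁅ y ⁆ x ≡ does (x ≟ y)
lookup-⁅⁆ zero zero = refl
lookup-⁅⁆ zero (suc x) = lookup-replicate x false
lookup-⁅⁆ (suc y) zero = refl
lookup-⁅⁆ (suc y) (suc x) = lookup-⁅⁆ y x

lookup-─ : ∀ {n} (p q : Subset n) x → lookup (p ─ q) x ≡ lookup p x ∧ not (lookup q x)
lookup-─ (s ∷ p) (true ∷ q) zero = sym (∧-zeroʳ s)
lookup-─ (s ∷ p) (false ∷ q) zero = sym (∧-identityʳ s)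
lookup-─ (s ∷ p) (t ∷ q) (suc x) = lookup-─ p q x

lookup-remove : ∀ {n} (p : Subset n) y x → lookup (p - y) x ≡ lookup p x ∧ not (does (x ≟ y))
lookup-remove p y x = trans (lookup-─ p ⁅ y ⁆ x) (cong (λ b → lookup p x ∧ not b) (lookup-⁅⁆ y x))

x∈p-y⁻ : ∀ {n} {p : Subset n} {x y} → x ∈ p - y → x ∈ p × x ≢ y
x∈p-y⁻ {p = p} {x} {y} x∈p-y with lookup p x in p[x] | x ≟ y | trans (sym (lookup-remove p y x)) ([]=⇒lookup x∈p-y)
... | true | no x≢y | _ = lookup⇒[]= x p p[x] , x≢y

x∈p-y⁺ : ∀ {n} {p : Subset n} {x y} → x ∈ p → x ≢ y → x ∈ p - y
x∈p-y⁺ {p = p} {x} {y} x∈p x≢y = lookup⇒[]= x (p - y) (begin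
  lookup (p - y) x              ≡⟨ lookup-remove p y x ⟩
  lookup p x ∧ not (does (x ≟ y)) ≡⟨ cong₂ (λ a b → a ∧ not b) ([]=⇒lookup x∈p) (dec-false (x ≟ y) x≢y) ⟩
  true                          ∎)
  where open ≡-Reasoning

Fin-inhabited? : ∀ n → Fin n ⊎ ¬ Fin n
Fin-inhabited? zero = inj₂ λ ()
Fin-inhabited? (suc n) = inj₁ zero

module Connectivity (G : Graph) where
  open Graph G

  inc : Fin n → Fin m → Bool
  inc v e = does (src e ≟ v) ∨ does (tgt e ≟ v)

  deg≡∑ : ∀ F v → deg G F v ≡ sum (λ e → 𝟙 (lookup F e ∧ inc v e))
  deg≡∑ F v = trans (∣p∣≡∑𝟙 (F ∩ incident G v)) (sum-cong-≗ λ e →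
    cong 𝟙 (trans (lookup-zipWith _∧_ e F _) (cong (lookup F e ∧_) (lookup∘tabulate _ e))))

  src-inc : ∀ e → inc (src e) e ≡ true
  src-inc e = cong (_∨ does (tgt e ≟ src e)) (dec-true (src e ≟ src e) refl)

  tgt-inc : ∀ e → inc (tgt e) e ≡ true
  tgt-inc e = trans (cong (does (src e ≟ tgt e) ∨_) (dec-true (tgt e ≟ tgt e) refl)) (∨-zeroʳ _)

  Joins⇒inc : ∀ {e u w} → Joins G e u w → inc u e ≡ true × inc w e ≡ true
  Joins⇒inc {e} (inj₁ (refl , refl)) = src-inc e , tgt-inc e
  Joins⇒inc {e} (inj₂ (refl , refl)) = tgt-inc e , src-inc e

  inc⇒endpoint : ∀ {e a b v} → Joins G e a b → inc v e ≡ true → v ≡ a ⊎ v ≡ b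
  inc⇒endpoint {e} {v = v} J inc≡true with src e ≟ v | tgt e ≟ v | J
  ... | yes refl | _ | inj₁ (refl , _) = inj₁ refl
  ... | yes refl | _ | inj₂ (refl , _) = inj₂ refl
  ... | no _ | yes refl | inj₁ (_ , refl) = inj₂ refl
  ... | no _ | yes refl | inj₂ (_ , refl) = inj₁ refl

  deg≢0⇒∃inc : ∀ F v → deg G F v ≢ 0 → ∃[ e ] e ∈ F × inc v e ≡ true
  deg≢0⇒∃inc F v deg≢0 with sum≢0⇒∃≢0 _ (deg≢0 ∘ trans (deg≡∑ F v))
  ... | e , ≢0 with lookup F e in F[e] | inc v e in e∋v
  ... | true | true = e , lookup⇒[]= e F F[e] , e∋v
  ... | true | false = ⊥-elim (≢0 refl)
  ... | false | _ = ⊥-elim (≢0 refl)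

  deg≢deg⊤⇒∃inc∉ : ∀ F v → deg G F v ≢ deg G ⊤ v → ∃[ e ] inc v e ≡ true × e ∉ F
  deg≢deg⊤⇒∃inc∉ F v deg≢ with ¬∀⟶∃¬ m (λ e → lookup F e ∧ inc v e ≡ inc v e) (λ e → lookup F e ∧ inc v e ≟ᵇ inc v e) all-inc∈F
    where
    all-inc∈F : ¬ (∀ e → lookup F e ∧ inc v e ≡ inc v e)
    all-inc∈F all = deg≢ (begin
      deg G F v                              ≡⟨ deg≡∑ F v ⟩
      sum (λ e → 𝟙 (lookup F e ∧ inc v e))   ≡⟨ sum-cong-≗ (λ e → cong 𝟙 (trans (all e) (cong (_∧ inc v e) (sym (lookup-replicate e true))))) ⟩
      sum (λ e → 𝟙 (lookup ⊤ e ∧ inc v e))   ≡⟨ deg≡∑ ⊤ v ⟨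
      deg G ⊤ v                              ∎)
      where open ≡-Reasoning
  ... | e , ≢inc with lookup F e in F[e] | inc v e in e∋v
  ... | false | true = e , e∋v , λ e∈F → contradiction (trans (sym ([]=⇒lookup e∈F)) F[e]) λ ()
  ... | true | true = ⊥-elim (≢inc refl)
  ... | _ | false = ⊥-elim (≢inc (∧-zeroʳ _))

  𝟙-∧-≤ : ∀ x y → 𝟙 (x ∧ y) ≤ 𝟙 y
  𝟙-∧-≤ true y = ≤-refl
  𝟙-∧-≤ false y = z≤n

  deg-at-cubic-vertex : ∀ {v a b c} → deg G ⊤ v ≡ 3 →
    inc v a ≡ true → inc v b ≡ true → inc v c ≡ true → b ≢ a → c ≢ a → c ≢ b →
    ∀ F → deg G F v ≡ 𝟙 (lookup F a) + (𝟙 (lookup F b) + 𝟙 (lookup F c))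
  deg-at-cubic-vertex {v} {a} {b} {c} deg⊤≡3 a∋v b∋v c∋v b≢a c≢a c≢b F = begin
    deg G F v                                                    ≡⟨ deg≡∑ F v ⟩
    sum (f F)                                                    ≡⟨ sum-split₃ (f F) b≢a c≢a c≢b ⟩
    f F a + (f F b + (f F c + sum (others F)))                   ≡⟨ cong (λ r → f F a + (f F b + (f F c + r))) others-vanish ⟩
    f F a + (f F b + (f F c + 0))                                ≡⟨ cong₂ _+_ (f-inc F a∋v) (cong₂ _+_ (f-inc F b∋v) (trans (+-identityʳ _) (f-inc F c∋v))) ⟩
    𝟙 (lookup F a) + (𝟙 (lookup F b) + 𝟙 (lookup F c))           ∎
    where
    open ≡-Reasoning
    f : EdgeSet G → Fin m → ℕ
    f F e = 𝟙 (lookup F e ∧ inc v e)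
    others : EdgeSet G → Fin m → ℕ
    others F = zeroAt c (zeroAt b (zeroAt a (f F)))
    f-inc : ∀ F {x} → inc v x ≡ true → f F x ≡ 𝟙 (lookup F x)
    f-inc F {x} x∋v = trans (cong (λ i → 𝟙 (lookup F x ∧ i)) x∋v) (cong 𝟙 (∧-identityʳ _))
    f⊤-inc : ∀ {x} → inc v x ≡ true → f ⊤ x ≡ 1
    f⊤-inc {x} x∋v = trans (f-inc ⊤ x∋v) (cong 𝟙 (lookup-replicate x true))
    others⊤-vanish : sum (others ⊤) ≡ 0
    others⊤-vanish = suc-injective (suc-injective (suc-injective (sym $ begin
      3                                                       ≡⟨ deg⊤≡3 ⟨
      deg G ⊤ v                                               ≡⟨ deg≡∑ ⊤ v ⟩
      sum (f ⊤)                                               ≡⟨ sum-split₃ (f ⊤) b≢a c≢a c≢b ⟩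
      f ⊤ a + (f ⊤ b + (f ⊤ c + sum (others ⊤)))              ≡⟨ cong₂ _+_ (f⊤-inc a∋v) (cong₂ _+_ (f⊤-inc b∋v) (cong (_+ sum (others ⊤)) (f⊤-inc c∋v))) ⟩
      3 + sum (others ⊤)                                      ∎)))
    f≤f⊤ : ∀ e → f F e ≤ f ⊤ e
    f≤f⊤ e = ≤-trans (𝟙-∧-≤ (lookup F e) (inc v e)) (≤-reflexive (cong (λ x → 𝟙 (x ∧ inc v e)) (sym (lookup-replicate e true))))
    others-vanish : sum (others F) ≡ 0
    others-vanish = n≤0⇒n≡0 (≤-trans (sum-mono-≤ (zeroAt-mono-≤ c (zeroAt-mono-≤ b (zeroAt-mono-≤ a f≤f⊤)))) (≤-reflexive others⊤-vanish))

  Joins-unique : ∀ {e a b c d} → Joins G e a b → Joins G e c d → (a ≡ c × b ≡ d) ⊎ (a ≡ d × b ≡ c)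
  Joins-unique (inj₁ (refl , refl)) (inj₁ (refl , refl)) = inj₁ (refl , refl)
  Joins-unique (inj₁ (refl , refl)) (inj₂ (refl , refl)) = inj₂ (refl , refl)
  Joins-unique (inj₂ (refl , refl)) (inj₁ (refl , refl)) = inj₂ (refl , refl)
  Joins-unique (inj₂ (refl , refl)) (inj₂ (refl , refl)) = inj₁ (refl , refl)

  Joins-sym : ∀ {e u w} → Joins G e u w → Joins G e w u
  Joins-sym (inj₁ p) = inj₂ p
  Joins-sym (inj₂ p) = inj₁ p

  Reach-trans : ∀ {F u v w} → Reach G F u v → Reach G F v w → Reach G F u w
  Reach-trans here q = q
  Reach-trans (step e e∈F J p) q = step e e∈F J (Reach-trans p q)

  Joins⇒Reach : ∀ {F e u w} → e ∈ F → Joins G e u w → Reach G F u w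
  Joins⇒Reach e∈F J = step _ e∈F J here

  Reach-sym : ∀ {F u v} → Reach G F u v → Reach G F v u
  Reach-sym here = here
  Reach-sym (step e e∈F J p) = Reach-trans (Reach-sym p) (Joins⇒Reach e∈F (Joins-sym J))

  ConnectedBy-from : ∀ {F} v₀ → (∀ x → Reach G F v₀ x) → ConnectedBy G F
  ConnectedBy-from v₀ reach u v = Reach-trans (Reach-sym (reach u)) (reach v)

  Reach-exit : ∀ {F F₀ x y} → Reach G F x y →
    Reach G F₀ x y ⊎ ∃[ e ] e ∈ F × e ∉ F₀ × ∃[ u ] ∃[ w ] (Joins G e u w × Reach G F₀ x u)
  Reach-exit here = inj₁ here
  Reach-exit {F₀ = F₀} (step e e∈F J p) with e ∈? F₀ | Reach-exit {F₀ = F₀} p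
  ... | no e∉F₀ | _ = inj₂ (e , e∈F , e∉F₀ , _ , _ , J , here)
  ... | yes e∈F₀ | inj₁ p₀ = inj₁ (step e e∈F₀ J p₀)
  ... | yes e∈F₀ | inj₂ (e' , e'∈F , e'∉F₀ , u , w , J' , p₀) = inj₂ (e' , e'∈F , e'∉F₀ , u , w , J' , step e e∈F₀ J p₀)

  Reach-bypass : ∀ {F e x y} → Reach G (F - e) (src e) (tgt e) → Reach G F x y → Reach G (F - e) x y
  Reach-bypass detour here = here
  Reach-bypass {e = e} detour (step e' e'∈F J p) with e' ≟ e | J
  ... | no e'≢e | _ = step e' (x∈p-y⁺ e'∈F e'≢e) J (Reach-bypass detour p)
  ... | yes refl | inj₁ (refl , refl) = Reach-trans detour (Reach-bypass detour p)
  ... | yes refl | inj₂ (refl , refl) = Reach-trans (Reach-sym detour) (Reach-bypass detour p)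

  Stable : EdgeSet G → (Fin n → Bool) → Set
  Stable F T = ∀ {e} → e ∈ F → T (src e) ≡ T (tgt e)

  Joins-endpoints : ∀ {e u w} (T : Fin n → Bool) → Joins G e u w → T u ≡ T w → T (src e) ≡ T (tgt e)
  Joins-endpoints T (inj₁ (refl , refl)) Tu≡Tw = Tu≡Tw
  Joins-endpoints T (inj₂ (refl , refl)) Tu≡Tw = sym Tu≡Tw

  Stable-Joins : ∀ {F T e u w} → Stable F T → e ∈ F → Joins G e u w → T u ≡ T w
  Stable-Joins stable e∈F (inj₁ (refl , refl)) = stable e∈F
  Stable-Joins stable e∈F (inj₂ (refl , refl)) = sym (stable e∈F)

  Stable-Reach : ∀ {F T x y} → Stable F T → Reach G F x y → T x ≡ T y
  Stable-Reach stable here = refl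
  Stable-Reach stable (step e e∈F J p) = trans (Stable-Joins stable e∈F J) (Stable-Reach stable p)

  Crossing : EdgeSet G → (Fin n → Bool) → Set
  Crossing F T = ∃[ e ] e ∈ F × T (src e) ≢ T (tgt e)

  crossing? : ∀ F T → Dec (Crossing F T)
  crossing? F T = any? (λ e → (e ∈? F) ×-dec ¬? (T (src e) ≟ᵇ T (tgt e)))

  ¬Crossing⇒Stable : ∀ {F T} → ¬ Crossing F T → Stable F T
  ¬Crossing⇒Stable {F} {T} ¬crossing {e} e∈F with T (src e) ≟ᵇ T (tgt e)
  ... | yes same = same
  ... | no differ = ⊥-elim (¬crossing (e , e∈F , differ))

  Reach⇒Crossing : ∀ {F T x y} → Reach G F x y → T x ≢ T y → Crossing F T
  Reach⇒Crossing {F} {T} p Tx≢Ty with crossing? F T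
  ... | yes crossing = crossing
  ... | no ¬crossing = ⊥-elim (Tx≢Ty (Stable-Reach {T = T} (¬Crossing⇒Stable {T = T} ¬crossing) p))

  Reach-restrict : ∀ {F F'} {T : Fin n → Bool} {b x y} → Stable F T → (∀ {e} → e ∈ F → T (src e) ≡ b → e ∈ F') →
    Reach G F x y → T x ≡ b → Reach G F' x y
  Reach-restrict stable keep here Tx≡b = here
  Reach-restrict {T = T} stable keep (step e e∈F J@(inj₁ (refl , refl)) p) Tx≡b =
    step e (keep e∈F Tx≡b) J (Reach-restrict {T = T} stable keep p (trans (sym (stable e∈F)) Tx≡b))
  Reach-restrict {T = T} stable keep (step e e∈F J@(inj₂ (refl , refl)) p) Tx≡b =
    step e (keep e∈F (trans (stable e∈F) Tx≡b)) J (Reach-restrict {T = T} stable keep p (trans (stable e∈F) Tx≡b))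

  record Component (F : EdgeSet G) (u : Fin n) : Set where
    field
      member : Fin n → Bool
      root : member u ≡ true
      stable : Stable F member
      reachable : ∀ {x} → member x ≡ true → Reach G F u x

    Reach⇒member : ∀ {x} → Reach G F u x → member x ≡ true
    Reach⇒member p = trans (sym (Stable-Reach {T = member} stable p)) root

  frontier : ∀ {F u S} → (∀ {x} → S x ≡ true → Reach G F u x) → Crossing F S →
    ∃[ w ] S w ≡ false × Reach G F u w
  frontier {S = S} reach (e , e∈F , differ) with S (src e) in S[s] | S (tgt e) in S[t]
  ... | true | false = tgt e , S[t] , Reach-trans (reach S[s]) (Joins⇒Reach e∈F (inj₁ (refl , refl)))
  ... | false | true = src e , S[s] , Reach-trans (reach S[t]) (Joins⇒Reach e∈F (inj₂ (refl , refl)))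
  ... | true | true = ⊥-elim (differ refl)
  ... | false | false = ⊥-elim (differ refl)

  insert : (Fin n → Bool) → Fin n → Fin n → Bool
  insert S w x = S x ∨ does (x ≟ w)

  ∑𝟙-insert : ∀ S w → S w ≡ false → sum (𝟙 ∘ insert S w) ≡ suc (sum (𝟙 ∘ S))
  ∑𝟙-insert S w Sw≡false = begin
    sum (𝟙 ∘ insert S w)                        ≡⟨ sum-split (𝟙 ∘ insert S w) w ⟩
    𝟙 (S w ∨ does (w ≟ w)) + sum (zeroAt w (𝟙 ∘ insert S w))
      ≡⟨ cong₂ _+_ (cong 𝟙 (trans (cong (S w ∨_) (dec-true (w ≟ w) refl)) (∨-zeroʳ _))) (sum-cong-≗ same-elsewhere) ⟩
    1 + sum (zeroAt w (𝟙 ∘ S))                  ≡⟨ cong (λ b → suc (𝟙 b + sum (zeroAt w (𝟙 ∘ S)))) Sw≡false ⟨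
    suc (𝟙 (S w) + sum (zeroAt w (𝟙 ∘ S)))     ≡⟨ cong suc (sum-split (𝟙 ∘ S) w) ⟨
    suc (sum (𝟙 ∘ S))                           ∎
    where
    open ≡-Reasoning
    same-elsewhere : ∀ x → zeroAt w (𝟙 ∘ insert S w) x ≡ zeroAt w (𝟙 ∘ S) x
    same-elsewhere x with x ≟ w
    ... | yes _ = refl
    ... | no _ = cong 𝟙 (∨-identityʳ (S x))

  -- Each step adds a new reachable vertex, so the invariant n ≤ fuel + |S| keeps fuel from running out.
  explore : ∀ {F u} fuel S → S u ≡ true → (∀ {x} → S x ≡ true → Reach G F u x) →
    n ≤ fuel + sum (𝟙 ∘ S) → Component F u
  explore {F} {u} fuel S Su reach bound with crossing? F S
  ... | no ¬crossing = record { member = S ; root = Su ; stable = ¬Crossing⇒Stable {T = S} ¬crossing ; reachable = reach }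
  ... | yes crossing with frontier reach crossing
  ... | w , Sw≡false , u⇝w = grow fuel bound
    where
    reach' : ∀ {x} → insert S w x ≡ true → Reach G F u x
    reach' {x} S'x with S x in Sx | x ≟ w
    ... | true | _ = reach Sx
    ... | false | yes refl = u⇝w
    grow : ∀ fuel → n ≤ fuel + sum (𝟙 ∘ S) → Component F u
    grow zero bound = ⊥-elim (<⇒≱ (∑𝟙<n S w Sw≡false) bound)
    grow (suc fuel) bound = explore fuel (insert S w) (cong (_∨ _) Su) reach'
      (subst (n ≤_) (trans (sym (+-suc fuel _)) (cong (fuel +_) (sym (∑𝟙-insert S w Sw≡false)))) bound)

  component : ∀ F u → Component F u
  component F u = explore n (λ x → does (x ≟ u)) (dec-true (u ≟ u) refl) start (m≤m+n n _)
    where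
    start : ∀ {x} → does (x ≟ u) ≡ true → Reach G F u x
    start {x} x≟u with does≡true⇒ (x ≟ u) x≟u
    ... | refl = here

  ∑-indicator : ∀ (T : Fin n → Bool) a → sum (λ x → 𝟙 (T x) * 𝟙 (does (a ≟ x))) ≡ 𝟙 (T a)
  ∑-indicator T a = begin
    sum (λ x → 𝟙 (T x) * 𝟙 (does (a ≟ x)))        ≡⟨ sum-split _ a ⟩
    𝟙 (T a) * 𝟙 (does (a ≟ a)) + sum (zeroAt a _) ≡⟨ cong₂ _+_ (cong (λ b → 𝟙 (T a) * 𝟙 b) (dec-true (a ≟ a) refl)) (sum-zero vanish) ⟩
    𝟙 (T a) * 1 + 0                                ≡⟨ trans (+-identityʳ _) (*-identityʳ _) ⟩
    𝟙 (T a)                                        ∎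
    where
    open ≡-Reasoning
    vanish : ∀ x → zeroAt a (λ x → 𝟙 (T x) * 𝟙 (does (a ≟ x))) x ≡ 0
    vanish x with x ≟ a | a ≟ x
    ... | yes _ | _ = refl
    ... | no _ | no _ = *-zeroʳ (𝟙 (T x))
    ... | no x≢a | yes a≡x = ⊥-elim (x≢a (sym a≡x))

  ∑-endpoints : ∀ (T : Fin n → Bool) e f →
    sum (λ x → 𝟙 (T x) * 𝟙 (f ∧ inc x e)) ≡ 𝟙 f * (𝟙 (T (src e)) + 𝟙 (T (tgt e)))
  ∑-endpoints T e false = sum-zero (λ x → *-zeroʳ (𝟙 (T x)))
  ∑-endpoints T e true = begin
    sum (λ x → 𝟙 (T x) * 𝟙 (inc x e))
      ≡⟨ sum-cong-≗ split-inc ⟩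
    sum (λ x → 𝟙 (T x) * 𝟙 (does (src e ≟ x)) + 𝟙 (T x) * 𝟙 (does (tgt e ≟ x)))
      ≡⟨ ∑-distrib-+ (λ x → 𝟙 (T x) * 𝟙 (does (src e ≟ x))) (λ x → 𝟙 (T x) * 𝟙 (does (tgt e ≟ x))) ⟩
    sum (λ x → 𝟙 (T x) * 𝟙 (does (src e ≟ x))) + sum (λ x → 𝟙 (T x) * 𝟙 (does (tgt e ≟ x)))
      ≡⟨ cong₂ _+_ (∑-indicator T (src e)) (∑-indicator T (tgt e)) ⟩
    𝟙 (T (src e)) + 𝟙 (T (tgt e))
      ≡⟨ *-identityˡ _ ⟨
    1 * (𝟙 (T (src e)) + 𝟙 (T (tgt e)))  ∎
    where
    open ≡-Reasoning
    𝟙-∨ : ∀ a b → ¬ (a ≡ true × b ≡ true) → 𝟙 (a ∨ b) ≡ 𝟙 a + 𝟙 b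
    𝟙-∨ true true not-both = ⊥-elim (not-both (refl , refl))
    𝟙-∨ true false _ = refl
    𝟙-∨ false b _ = refl
    split-inc : ∀ x → 𝟙 (T x) * 𝟙 (inc x e) ≡ 𝟙 (T x) * 𝟙 (does (src e ≟ x)) + 𝟙 (T x) * 𝟙 (does (tgt e ≟ x))
    split-inc x = trans (cong (𝟙 (T x) *_) (𝟙-∨ (does (src e ≟ x)) (does (tgt e ≟ x)) λ (s≡x , t≡x) →
                          loopless e (trans (does≡true⇒ (src e ≟ x) s≡x) (sym (does≡true⇒ (tgt e ≟ x) t≡x)))))
                        (*-distribˡ-+ (𝟙 (T x)) _ _)

  handshake : ∀ F (T : Fin n → Bool) →
    sum (λ x → 𝟙 (T x) * deg G F x) ≡ sum (λ e → 𝟙 (lookup F e) * (𝟙 (T (src e)) + 𝟙 (T (tgt e))))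
  handshake F T = begin
    sum (λ x → 𝟙 (T x) * deg G F x)                                ≡⟨ sum-cong-≗ (λ x → cong (𝟙 (T x) *_) (deg≡∑ F x)) ⟩
    sum (λ x → 𝟙 (T x) * sum (λ e → 𝟙 (lookup F e ∧ inc x e)))     ≡⟨ sum-cong-≗ (λ x → *-distribˡ-sum (𝟙 (T x)) (λ e → 𝟙 (lookup F e ∧ inc x e))) ⟩
    sum (λ x → sum (λ e → 𝟙 (T x) * 𝟙 (lookup F e ∧ inc x e)))     ≡⟨ ∑-comm (λ x e → 𝟙 (T x) * 𝟙 (lookup F e ∧ inc x e)) ⟩
    sum (λ e → sum (λ x → 𝟙 (T x) * 𝟙 (lookup F e ∧ inc x e)))     ≡⟨ sum-cong-≗ (λ e → ∑-endpoints T e (lookup F e)) ⟩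
    sum (λ e → 𝟙 (lookup F e) * (𝟙 (T (src e)) + 𝟙 (T (tgt e))))   ∎
    where open ≡-Reasoning

  -- Otherwise the component T of src e in F - e misses tgt e, and ∑_{x∈T} deg x = 2|T| would
  -- count e once and every other edge of F twice or not at all.
  2-regular⇒bridgeless : ∀ {F} → (∀ v → deg G F v ≡ 2) → ∀ {e} → e ∈ F → Reach G (F - e) (src e) (tgt e)
  2-regular⇒bridgeless {F} deg≡2 {e} e∈F with component (F - e) (src e)
  ... | C with Component.member C (tgt e) in T[t]
  ... | true = Component.reachable C T[t]
  ... | false = ⊥-elim (even≢odd (sum (𝟙 ∘ T)) (sum g) (trans (sym even) odd))
    where
    open Component C renaming (member to T)
    h g : Fin m → ℕ
    h e' = 𝟙 (lookup F e') * (𝟙 (T (src e')) + 𝟙 (T (tgt e')))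
    g = zeroAt e (λ e' → 𝟙 (lookup F e') * 𝟙 (T (src e')))
    h[e]≡1 : h e ≡ 1
    h[e]≡1 rewrite []=⇒lookup e∈F | root | T[t] = refl
    other-edges : ∀ e' → zeroAt e h e' ≡ 2 * g e'
    other-edges e' with e' ≟ e
    ... | yes _ = refl
    ... | no e'≢e with lookup F e' in F[e']
    ...   | false = refl
    ...   | true rewrite stable (x∈p-y⁺ (lookup⇒[]= e' F F[e']) e'≢e) with T (tgt e')
    ...     | true = refl
    ...     | false = refl
    even : sum (λ x → 𝟙 (T x) * deg G F x) ≡ 2 * sum (𝟙 ∘ T)
    even = trans (sum-cong-≗ (λ x → trans (cong (𝟙 (T x) *_) (deg≡2 x)) (*-comm (𝟙 (T x)) 2)))
                 (sym (*-distribˡ-sum 2 (𝟙 ∘ T)))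
    odd : sum (λ x → 𝟙 (T x) * deg G F x) ≡ suc (2 * sum g)
    odd = begin
      sum (λ x → 𝟙 (T x) * deg G F x)  ≡⟨ handshake F T ⟩
      sum h                            ≡⟨ sum-split h e ⟩
      h e + sum (zeroAt e h)           ≡⟨ cong₂ _+_ h[e]≡1 (sum-cong-≗ other-edges) ⟩
      1 + sum (λ e' → 2 * g e')        ≡⟨ cong suc (*-distribˡ-sum 2 g) ⟨
      suc (2 * sum g)                  ∎
      where open ≡-Reasoning

  -- Trading a = A₀A₁ and b = B₀B₁ for c = A₁B₀: the component of v₀ stays connected without a,
  -- what B₀ reaches stays connected without b, and c joins the two.
  switch-connects : ∀ {F F' v₀} → (∀ v → deg G F v ≡ 2) → (C : Component F v₀) →
    ∀ {a b c A₀ A₁ B₀ B₁} → Joins G a A₀ A₁ → Joins G b B₀ B₁ → Joins G c A₁ B₀ →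
    a ∈ F → b ∈ F → c ∈ F' → Component.member C A₀ ≡ true → Component.member C B₀ ≡ false →
    (∀ {e} → e ∈ F → e ≢ a → e ≢ b → e ∈ F') →
    ∀ {x} → Component.member C x ≡ true ⊎ Reach G F B₀ x → Reach G F' v₀ x
  switch-connects {F} {F'} {v₀} deg≡2 C {a} {b} {c} {A₀} {A₁} {B₀} {B₁} Ja Jb Jc a∈F b∈F c∈F' T[A₀] T[B₀] keep
    = [ inside , outside ]
    where
    open Component C renaming (member to T)
    src-coloured : ∀ {e u w β} → Joins G e u w → T u ≡ β → T w ≡ β → T (src e) ≡ β
    src-coloured (inj₁ (refl , _)) T[u] _ = T[u]
    src-coloured (inj₂ (refl , _)) _ T[w] = T[w]
    T[A₁] : T A₁ ≡ true
    T[A₁] = trans (sym (Stable-Joins {T = T} stable a∈F Ja)) T[A₀]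
    T[B₁] : T B₁ ≡ false
    T[B₁] = trans (sym (Stable-Joins {T = T} stable b∈F Jb)) T[B₀]
    stable-without : ∀ d → Stable (F - d) T
    stable-without d e∈F-d = stable (proj₁ (x∈p-y⁻ e∈F-d))
    keep-inside : ∀ {e} → e ∈ F - a → T (src e) ≡ true → e ∈ F'
    keep-inside e∈F-a T[s] with x∈p-y⁻ e∈F-a
    ... | e∈F , e≢a = keep e∈F e≢a λ { refl → contradiction (trans (sym T[s]) (src-coloured Jb T[B₀] T[B₁])) λ () }
    keep-outside : ∀ {e} → e ∈ F - b → T (src e) ≡ false → e ∈ F'
    keep-outside e∈F-b T[s] with x∈p-y⁻ e∈F-b
    ... | e∈F , e≢b = keep e∈F (λ { refl → contradiction (trans (sym (src-coloured Ja T[A₀] T[A₁])) T[s]) λ () }) e≢b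
    inside : ∀ {x} → T x ≡ true → Reach G F' v₀ x
    inside T[x] = Reach-restrict {T = T} (stable-without a) keep-inside
      (Reach-bypass (2-regular⇒bridgeless deg≡2 a∈F) (reachable T[x])) root
    outside : ∀ {x} → Reach G F B₀ x → Reach G F' v₀ x
    outside p = Reach-trans (inside T[A₁]) (step c c∈F' Jc (Reach-restrict {T = T} (stable-without b) keep-outside
      (Reach-bypass (2-regular⇒bridgeless deg≡2 b∈F) p) T[B₀]))

module SquareGraphs (G : Graph) (M : EdgeSet G) (SG : SquareGraph G M) where
  open Graph G
  open Connectivity G
  open SquareGraph SG

  next : Fin 4 → Fin 4
  next = next4 G

  prev : Fin 4 → Fin 4
  prev 0F = 3F
  prev 1F = 0F
  prev 2F = 1F
  prev 3F = 2F

  odd : Fin 4 → Bool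
  odd 0F = false
  odd 1F = true
  odd 2F = false
  odd 3F = true

  next-prev : ∀ t → next (prev t) ≡ t
  next-prev 0F = refl
  next-prev 1F = refl
  next-prev 2F = refl
  next-prev 3F = refl

  odd-prev : ∀ t → odd (prev t) ≡ not (odd t)
  odd-prev 0F = refl
  odd-prev 1F = refl
  odd-prev 2F = refl
  odd-prev 3F = refl

  odd-next : ∀ t → odd (next t) ≡ not (odd t)
  odd-next 0F = refl
  odd-next 1F = refl
  odd-next 2F = refl
  odd-next 3F = refl

  prev≢id : ∀ t → prev t ≢ t
  prev≢id 0F ()
  prev≢id 1F ()
  prev≢id 2F ()
  prev≢id 3F ()

  next²≢id : ∀ t → next (next t) ≢ t
  next²≢id 0F ()
  next²≢id 1F ()
  next²≢id 2F ()
  next²≢id 3F ()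

  same-parity : ∀ t u → odd t ≡ odd u → t ≡ u ⊎ t ≡ next (next u)
  same-parity 0F 0F _ = inj₁ refl
  same-parity 0F 2F _ = inj₂ refl
  same-parity 1F 1F _ = inj₁ refl
  same-parity 1F 3F _ = inj₂ refl
  same-parity 2F 0F _ = inj₂ refl
  same-parity 2F 2F _ = inj₁ refl
  same-parity 3F 1F _ = inj₂ refl
  same-parity 3F 3F _ = inj₁ refl
  same-parity 0F 3F ()
  same-parity 2F 3F ()

  corner : Fin k → Fin 4 → Fin n
  corner i = Square.vs (square i)

  side : Fin k → Fin 4 → Fin m
  side i = Square.es (square i)

  side-joins : ∀ i t → Joins G (side i t) (corner i t) (corner i (next t))
  side-joins i = Square.es-joins (square i)

  corner-injective : ∀ {i t t'} → corner i t ≡ corner i t' → t ≡ t'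
  corner-injective {i} = Square.vs-distinct (square i)

  side-injective : ∀ {i t i' t'} → side i t ≡ side i' t' → i ≡ i' × t ≡ t'
  side-injective {i} {t} {i'} {t'} eq
    with Joins-unique (side-joins i t) (subst (λ e → Joins G e (corner i' t') (corner i' (next t'))) (sym eq) (side-joins i' t'))
  ... | inj₁ (same-start , _) with node-disjoint i i' t t' same-start
  ... | refl = refl , corner-injective same-start
  side-injective {i} {t} {i'} {t'} eq | inj₂ (start≡end , end≡start) with node-disjoint i i' t (next t') start≡end
  ... | refl = ⊥-elim (next²≢id t (trans (cong next (corner-injective end≡start)) (sym (corner-injective start≡end))))

  side∉M : ∀ i t → side i t ∉ M
  side∉M i t = proj₂ (nonM-are-square-edges (side i t)) (i , t , refl)

  ∉M⇒side : ∀ {e} → e ∉ M → ∃[ i ] ∃[ t ] side i t ≡ e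
  ∉M⇒side {e} = proj₁ (nonM-are-square-edges e)

  matching-edge : ∀ v → ∃[ e ] e ∈ M × inc v e ≡ true
  matching-edge v = deg≢0⇒∃inc M v (λ deg≡0 → contradiction (trans (sym (perfect v)) deg≡0) λ ())

  matched : Fin k → Fin 4 → Fin m
  matched i t = proj₁ (matching-edge (corner i t))

  matched∈M : ∀ i t → matched i t ∈ M
  matched∈M i t = proj₁ (proj₂ (matching-edge (corner i t)))

  every-vertex-is-a-corner : ∀ v → ∃[ i ] ∃[ t ] corner i t ≡ v
  every-vertex-is-a-corner v
    with deg≢deg⊤⇒∃inc∉ M v (λ deg≡ → contradiction (trans (sym (perfect v)) (trans deg≡ (cubic v))) λ ())
  ... | e , e∋v , e∉M with ∉M⇒side e∉M
  ... | i , t , refl with inc⇒endpoint (side-joins i t) e∋v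
  ... | inj₁ v≡start = i , t , sym v≡start
  ... | inj₂ v≡end = i , next t , sym v≡end

  deg-at-corner : ∀ i t F → deg G F (corner i t) ≡
    𝟙 (lookup F (matched i t)) + (𝟙 (lookup F (side i t)) + 𝟙 (lookup F (side i (prev t))))
  deg-at-corner i t = deg-at-cubic-vertex (cubic (corner i t))
    (proj₂ (proj₂ (matching-edge (corner i t))))
    (proj₁ (Joins⇒inc (side-joins i t)))
    (subst (λ t' → inc (corner i t') (side i (prev t)) ≡ true) (next-prev t) (proj₂ (Joins⇒inc (side-joins i (prev t)))))
    (λ eq → side∉M i t (subst (_∈ M) (sym eq) (matched∈M i t)))
    (λ eq → side∉M i (prev t) (subst (_∈ M) (sym eq) (matched∈M i t)))
    (λ eq → prev≢id t (proj₂ (side-injective eq)))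

  Choice : Set
  Choice = Fin k → Bool

  -- Square i contributes the sides t with odd t ≡ s i, one of the two perfect matchings of its 4-cycle.
  chosen : Choice → (e : Fin m) → Dec (e ∈ M) → Bool
  chosen s e (yes _) = true
  chosen s e (no e∉M) = let i , t , _ = ∉M⇒side e∉M in does (odd t ≟ᵇ s i)

  twoFactor : Choice → EdgeSet G
  twoFactor s = tabulate (λ e → chosen s e (e ∈? M))

  lookup-twoFactor-M : ∀ s {e} → e ∈ M → lookup (twoFactor s) e ≡ true
  lookup-twoFactor-M s {e} e∈M = trans (lookup∘tabulate _ e) (chosen-M (e ∈? M))
    where
    chosen-M : (d : Dec (e ∈ M)) → chosen s e d ≡ true
    chosen-M (yes _) = refl
    chosen-M (no e∉M) = ⊥-elim (e∉M e∈M)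

  lookup-twoFactor-side : ∀ s i t → lookup (twoFactor s) (side i t) ≡ does (odd t ≟ᵇ s i)
  lookup-twoFactor-side s i t = trans (lookup∘tabulate _ (side i t)) (chosen-side (side i t ∈? M))
    where
    chosen-side : (d : Dec (side i t ∈ M)) → chosen s (side i t) d ≡ does (odd t ≟ᵇ s i)
    chosen-side (yes side∈M) = ⊥-elim (side∉M i t side∈M)
    chosen-side (no side∉M') with ∉M⇒side side∉M'
    ... | i' , t' , eq with side-injective eq
    ... | refl , refl = refl

  M⊆twoFactor : ∀ s → M ⊆ twoFactor s
  M⊆twoFactor s {e} e∈M = lookup⇒[]= e (twoFactor s) (lookup-twoFactor-M s e∈M)

  side∈twoFactor : ∀ {s i t} → odd t ≡ s i → side i t ∈ twoFactor s
  side∈twoFactor {s} {i} {t} odd≡ = lookup⇒[]= (side i t) (twoFactor s) (trans (lookup-twoFactor-side s i t) (dec-true (odd t ≟ᵇ s i) odd≡))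

  side∈twoFactor⁻ : ∀ {s i t} → side i t ∈ twoFactor s → odd t ≡ s i
  side∈twoFactor⁻ {s} {i} {t} side∈ = does≡true⇒ (odd t ≟ᵇ s i) (trans (sym (lookup-twoFactor-side s i t)) ([]=⇒lookup side∈))

  twoFactor-cong : ∀ {s s'} → (∀ i → s i ≡ s' i) → twoFactor s ≡ twoFactor s'
  twoFactor-cong s≗s' = tabulate-cong chosen-cong
    where
    chosen-cong : ∀ e → chosen _ e (e ∈? M) ≡ chosen _ e (e ∈? M)
    chosen-cong e with e ∈? M
    ... | yes _ = refl
    ... | no e∉M = cong (λ b → does (odd (proj₁ (proj₂ (∉M⇒side e∉M))) ≟ᵇ b)) (s≗s' (proj₁ (∉M⇒side e∉M)))

  twoFactor-2-regular : ∀ s v → deg G (twoFactor s) v ≡ 2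
  twoFactor-2-regular s v with every-vertex-is-a-corner v
  ... | i , t , refl = begin
    deg G (twoFactor s) (corner i t)
      ≡⟨ deg-at-corner i t (twoFactor s) ⟩
    𝟙 (lookup (twoFactor s) (matched i t)) + (𝟙 (lookup (twoFactor s) (side i t)) + 𝟙 (lookup (twoFactor s) (side i (prev t))))
      ≡⟨ cong₂ (λ a b → 𝟙 (lookup (twoFactor s) (matched i t)) + (𝟙 a + 𝟙 b)) (lookup-twoFactor-side s i t) (lookup-twoFactor-side s i (prev t)) ⟩
    𝟙 (lookup (twoFactor s) (matched i t)) + (𝟙 (does (odd t ≟ᵇ s i)) + 𝟙 (does (odd (prev t) ≟ᵇ s i)))
      ≡⟨ cong₂ (λ a p → 𝟙 a + (𝟙 (does (odd t ≟ᵇ s i)) + 𝟙 (does (p ≟ᵇ s i)))) (lookup-twoFactor-M s (matched∈M i t)) (odd-prev t) ⟩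
    1 + (𝟙 (does (odd t ≟ᵇ s i)) + 𝟙 (does (not (odd t) ≟ᵇ s i)))
      ≡⟨ cong suc (exactly-one (odd t) (s i)) ⟩
    2 ∎
    where
    open ≡-Reasoning
    exactly-one : ∀ p b → 𝟙 (does (p ≟ᵇ b)) + 𝟙 (does (not p ≟ᵇ b)) ≡ 1
    exactly-one false false = refl
    exactly-one false true = refl
    exactly-one true false = refl
    exactly-one true true = refl

  alternating⇒parity : ∀ (h : Fin 4 → Bool) → (∀ t → h t ≡ not (h (prev t))) → ∀ t → h t ≡ does (odd t ≟ᵇ not (h 0F))
  alternating⇒parity h alt 0F with h 0F
  ... | true = refl
  ... | false = refl
  alternating⇒parity h alt 1F rewrite alt 1F with h 0F
  ... | true = refl
  ... | false = refl
  alternating⇒parity h alt 2F rewrite alt 2F | alt 1F with h 0F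
  ... | true = refl
  ... | false = refl
  alternating⇒parity h alt 3F rewrite alt 3F | alt 2F | alt 1F with h 0F
  ... | true = refl
  ... | false = refl

  2-regular⇒twoFactor : ∀ {H} → (∀ v → deg G H v ≡ 2) → M ⊆ H → ∃[ s ] H ≡ twoFactor s
  2-regular⇒twoFactor {H} deg≡2 M⊆H = s , Subset-ext agree
    where
    open ≡-Reasoning
    h : Fin k → Fin 4 → Bool
    h i t = lookup H (side i t)
    s : Choice
    s i = not (h i 0F)
    one-of-two : ∀ {a b} → 𝟙 a + 𝟙 b ≡ 1 → a ≡ not b
    one-of-two {true} {false} _ = refl
    one-of-two {false} {true} _ = refl
    alternating : ∀ i t → h i t ≡ not (h i (prev t))
    alternating i t = one-of-two (suc-injective (begin
      1 + (𝟙 (h i t) + 𝟙 (h i (prev t)))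
        ≡⟨ cong (λ b → 𝟙 b + (𝟙 (h i t) + 𝟙 (h i (prev t)))) ([]=⇒lookup (M⊆H (matched∈M i t))) ⟨
      𝟙 (lookup H (matched i t)) + (𝟙 (h i t) + 𝟙 (h i (prev t)))
        ≡⟨ deg-at-corner i t H ⟨
      deg G H (corner i t)
        ≡⟨ deg≡2 (corner i t) ⟩
      2 ∎))
    agree : ∀ e → lookup H e ≡ lookup (twoFactor s) e
    agree e with e ∈? M
    ... | yes e∈M = trans ([]=⇒lookup (M⊆H e∈M)) (sym (lookup-twoFactor-M s e∈M))
    ... | no e∉M with ∉M⇒side e∉M
    ... | i , t , refl = trans (alternating⇒parity (h i) (alternating i) t) (sym (lookup-twoFactor-side s i t))

  side∈twoFactor-transfer : ∀ {s s' i t} → s i ≡ s' i → side i t ∈ twoFactor s → side i t ∈ twoFactor s'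
  side∈twoFactor-transfer s≡s' side∈ = side∈twoFactor (trans (side∈twoFactor⁻ side∈) s≡s')

  flip : Fin k → Choice → Choice
  flip q s i = s i xor does (i ≟ q)

  flip-≡ : ∀ q s → flip q s q ≡ not (s q)
  flip-≡ q s = trans (cong (s q xor_) (dec-true (q ≟ q) refl)) (xor-comm (s q) true)

  flip-≢ : ∀ {q i} s → i ≢ q → flip q s i ≡ s i
  flip-≢ {q} {i} s i≢q = trans (cong (s i xor_) (dec-false (i ≟ q) i≢q)) (xor-identityʳ (s i))

  -- The first corner, in cyclic order, of the side of parity b at corner t.
  sideStart : Bool → Fin 4 → Fin 4
  sideStart b t = if does (odd t ≟ᵇ b) then t else prev t

  odd-sideStart : ∀ b t → odd (sideStart b t) ≡ b
  odd-sideStart b t with odd t ≟ᵇ b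
  ... | yes odd≡b = odd≡b
  ... | no odd≢b = trans (odd-prev t) (trans (cong not (¬-not odd≢b)) (not-involutive b))

  Reach-sideStart : ∀ s i t → Reach G (twoFactor s) (corner i t) (corner i (sideStart (s i) t))
  Reach-sideStart s i t with odd t ≟ᵇ s i | odd-sideStart (s i) t
  ... | yes _ | _ = here
  ... | no _ | odd-prev≡ = Reach-sym (Joins⇒Reach (side∈twoFactor odd-prev≡)
    (subst (λ t' → Joins G (side i (prev t)) (corner i (prev t)) (corner i t')) (next-prev t) (side-joins i (prev t))))

  member-sideStart : ∀ s {v₀} (C : Component (twoFactor s) v₀) q t →
    Component.member C (corner q (sideStart (s q) t)) ≡ Component.member C (corner q t)
  member-sideStart s C q t = sym (Stable-Reach {T = Component.member C} (Component.stable C) (Reach-sideStart s q t))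

  sideStart-opposite : ∀ s {v₀} (C : Component (twoFactor s) v₀) q {t₁ t₂} →
    Component.member C (corner q t₁) ≡ true → Component.member C (corner q t₂) ≡ false →
    sideStart (s q) t₂ ≡ next (next (sideStart (s q) t₁))
  sideStart-opposite s C q {t₁} {t₂} T[t₁] T[t₂]
    with same-parity (sideStart (s q) t₂) (sideStart (s q) t₁) (trans (odd-sideStart (s q) t₂) (sym (odd-sideStart (s q) t₁)))
  ... | inj₂ opposite = opposite
  ... | inj₁ same = contradiction (begin
    true                                   ≡⟨ T[t₁] ⟨
    T (corner q t₁)                        ≡⟨ member-sideStart s C q t₁ ⟨
    T (corner q (sideStart (s q) t₁))      ≡⟨ cong (T ∘ corner q) same ⟨
    T (corner q (sideStart (s q) t₂))      ≡⟨ member-sideStart s C q t₂ ⟩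
    T (corner q t₂)                        ≡⟨ T[t₂] ⟩
    false                                  ∎) λ ()
    where
    open ≡-Reasoning
    T = Component.member C

  flip-merges : ∀ s {v₀} (C : Component (twoFactor s) v₀) q {t₁ t₂} →
    Component.member C (corner q t₁) ≡ true → Component.member C (corner q t₂) ≡ false →
    ∃[ B₀ ] Component.member C B₀ ≡ false ×
      (∀ {x} → Component.member C x ≡ true ⊎ Reach G (twoFactor s) B₀ x → Reach G (twoFactor (flip q s)) v₀ x)
  flip-merges s C q {t₁} {t₂} T[t₁] T[t₂] = corner q (next (next u)) , T[B₀] ,
    switch-connects (twoFactor-2-regular s) C (side-joins q u) (side-joins q (next (next u))) (side-joins q (next u))
      (side∈twoFactor odd-u) (side∈twoFactor (trans (odd-next² u) odd-u)) (side∈twoFactor odd-next-u)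
      (trans (member-sideStart s C q t₁) T[t₁]) T[B₀] keep
    where
    T = Component.member C
    u = sideStart (s q) t₁
    odd-u : odd u ≡ s q
    odd-u = odd-sideStart (s q) t₁
    odd-next² : ∀ t → odd (next (next t)) ≡ odd t
    odd-next² t = trans (odd-next (next t)) (trans (cong not (odd-next t)) (not-involutive (odd t)))
    odd-next-u : odd (next u) ≡ flip q s q
    odd-next-u = trans (odd-next u) (trans (cong not odd-u) (sym (flip-≡ q s)))
    T[B₀] : T (corner q (next (next u))) ≡ false
    T[B₀] = trans (cong (T ∘ corner q) (sym (sideStart-opposite s C q T[t₁] T[t₂]))) (trans (member-sideStart s C q t₂) T[t₂])
    keep : ∀ {e} → e ∈ twoFactor s → e ≢ side q u → e ≢ side q (next (next u)) → e ∈ twoFactor (flip q s)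
    keep {e} e∈ e≢a e≢b with e ∈? M
    ... | yes e∈M = M⊆twoFactor (flip q s) e∈M
    ... | no e∉M with ∉M⇒side e∉M
    ... | i , t , refl with i ≟ q
    ...   | no i≢q = side∈twoFactor-transfer (sym (flip-≢ s i≢q)) e∈
    ...   | yes refl with same-parity t u (trans (side∈twoFactor⁻ e∈) (sym odd-u))
    ...     | inj₁ refl = ⊥-elim (e≢a refl)
    ...     | inj₂ refl = ⊥-elim (e≢b refl)

  Straddles : (Fin n → Bool) → Fin k → Set
  Straddles T q = (∃[ t ] T (corner q t) ≡ true) × (∃[ t ] T (corner q t) ≡ false)

  side-straddles : ∀ (T : Fin n → Bool) {q t} → T (src (side q t)) ≢ T (tgt (side q t)) → Straddles T q
  side-straddles T {q} {t} crossing with T (corner q t) in T[t] | T (corner q (next t)) in T[t+1]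
  ... | true | false = (t , T[t]) , (next t , T[t+1])
  ... | false | true = (next t , T[t+1]) , (t , T[t])
  ... | true | true = ⊥-elim (crossing (Joins-endpoints T (side-joins q t) (trans T[t] (sym T[t+1]))))
  ... | false | false = ⊥-elim (crossing (Joins-endpoints T (side-joins q t) (trans T[t] (sym T[t+1]))))

  crossing-side : ∀ s {v₀} (C : Component (twoFactor s) v₀) {e} →
    Component.member C (src e) ≢ Component.member C (tgt e) → ∃[ q ] ∃[ t ] side q t ≡ e
  crossing-side s C {e} crossing with e ∈? M
  ... | yes e∈M = ⊥-elim (crossing (Component.stable C (M⊆twoFactor s e∈M)))
  ... | no e∉M = ∉M⇒side e∉M

  merge-grows : ∀ {F F' v₀} (C : Component F v₀) {B₀} → Component.member C B₀ ≡ false →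
    (∀ {x} → Component.member C x ≡ true ⊎ Reach G F B₀ x → Reach G F' v₀ x) →
    sum (𝟙 ∘ Component.member C) < sum (𝟙 ∘ Component.member (component F' v₀))
  merge-grows {F' = F'} {v₀} C {B₀} T[B₀] merged = sum-mono-< (λ x → 𝟙-mono (Reach⇒member ∘ merged ∘ inj₁)) B₀
    (subst (λ b → 𝟙 b < 𝟙 (T' B₀)) (sym T[B₀]) (subst (λ b → 0 < 𝟙 b) (sym (Reach⇒member (merged (inj₂ here)))) (s≤s z≤n)))
    where
    open Component (component F' v₀) using (Reach⇒member) renaming (member to T')
    𝟙-mono : ∀ {a b} → (a ≡ true → b ≡ true) → 𝟙 a ≤ 𝟙 b
    𝟙-mono {true} a⇒b rewrite a⇒b refl = ≤-refl
    𝟙-mono {false} _ = z≤n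

  flip-grows : ∀ s {v₀} (C : Component (twoFactor s) v₀) {w} → Component.member C w ≡ false →
    ∃[ q ] sum (𝟙 ∘ Component.member C) < sum (𝟙 ∘ Component.member (component (twoFactor (flip q s)) v₀))
  flip-grows s {v₀} C {w} T[w]
    with Reach⇒Crossing {T = Component.member C} (proj₁ twoEdgeConnected v₀ w) (λ eq → contradiction (trans (trans (sym (Component.root C)) eq) T[w]) λ ())
  ... | e , _ , crossing with crossing-side s C crossing
  ... | q , t , refl with side-straddles (Component.member C) crossing
  ... | (t₁ , T[t₁]) , (t₂ , T[t₂]) with flip-merges s C q T[t₁] T[t₂]
  ... | B₀ , T[B₀] , merged = q , merge-grows C T[B₀] merged

  hamiltonian-exists : ∃[ s ] ConnectedBy G (twoFactor s)
  hamiltonian-exists with Fin-inhabited? n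
  ... | inj₂ no-vertex = (λ _ → false) , λ u → ⊥-elim (no-vertex u)
  ... | inj₁ v₀ = grow n (λ _ → false) (component _ v₀) (m≤m+n n _)
    where
    grow : ∀ fuel s (C : Component (twoFactor s) v₀) → n ≤ fuel + sum (𝟙 ∘ Component.member C) →
      ∃[ s ] ConnectedBy G (twoFactor s)
    grow fuel s C bound with all? (λ x → Component.member C x ≟ᵇ true)
    ... | yes all = s , ConnectedBy-from v₀ (λ x → Component.reachable C (all x))
    ... | no ¬all with ¬∀⟶∃¬ n _ (λ x → Component.member C x ≟ᵇ true) ¬all
    ... | w , T[w]≢true with flip-grows s C (¬-not T[w]≢true) | fuel
    ... | _ , _ | zero = ⊥-elim (<⇒≱ (∑𝟙<n (Component.member C) w (¬-not T[w]≢true)) bound)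
    ... | q , grows | suc fuel' = grow fuel' (flip q s) C'
      (≤-trans bound (subst (_≤ fuel' + sum (𝟙 ∘ Component.member C')) (+-suc fuel' _) (+-monoʳ-≤ fuel' grows)))
      where C' = component (twoFactor (flip q s)) v₀

  lost-side : ∀ {s q e} → e ∈ twoFactor s → e ∉ twoFactor (flip q s) → ∃[ t ] side q t ≡ e
  lost-side {s} {q} {e} e∈ e∉ with e ∈? M
  ... | yes e∈M = ⊥-elim (e∉ (M⊆twoFactor (flip q s) e∈M))
  ... | no e∉M with ∉M⇒side e∉M
  ... | i , t , refl with i ≟ q
  ...   | yes refl = t , refl
  ...   | no i≢q = ⊥-elim (e∉ (side∈twoFactor-transfer (sym (flip-≢ s i≢q)) e∈))

  flip-component-meets-square : ∀ s → ConnectedBy G (twoFactor s) → ∀ q {v₀} (C : Component (twoFactor (flip q s)) v₀) →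
    ∀ {x} → Component.member C x ≡ false → ∃[ t ] Component.member C (corner q t) ≡ true
  flip-component-meets-square s connected q {v₀} C {x} T[x]
    with Reach⇒Crossing {T = T} (connected v₀ x) (λ eq → contradiction (trans (trans (sym root) eq) T[x]) λ ())
    where open Component C renaming (member to T)
  ... | e , e∈ , crossing with e ∈? twoFactor (flip q s)
  ...   | yes e∈' = ⊥-elim (crossing (Component.stable C e∈'))
  ...   | no e∉' with lost-side e∈ e∉'
  ...     | t , refl = proj₁ (side-straddles (Component.member C) crossing)

  flip-splits-in-two : ∀ s → ConnectedBy G (twoFactor s) → ∀ q {v₀} (C : Component (twoFactor (flip q s)) v₀) →
    ∀ {x y} → Component.member C x ≡ false → Component.member C y ≡ false → Reach G (twoFactor (flip q s)) x y
  flip-splits-in-two s connected q C {x} {y} T[x] T[y] with flip-component-meets-square s connected q C T[x]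
  ... | t₀ , T[t₀] = Reach-trans (to-far-start T[x]) (Reach-sym (to-far-start T[y]))
    where
    open Component C renaming (member to T)
    F = twoFactor (flip q s)
    to-square : ∀ z → ∃[ t ] Reach G F z (corner q t)
    to-square z with Reach-exit {F₀ = F} (connected z (corner q 0F))
    ... | inj₁ p = 0F , p
    ... | inj₂ (e , e∈ , e∉ , u , _ , J , p) with lost-side e∈ e∉
    ...   | t , refl with Joins-unique J (side-joins q t)
    ...     | inj₁ (refl , _) = t , p
    ...     | inj₂ (refl , _) = next t , p
    to-far-start : ∀ {z} → T z ≡ false → Reach G F z (corner q (next (next (sideStart (flip q s q) t₀))))
    to-far-start {z} T[z] with to-square z
    ... | t , p = subst (λ t' → Reach G F z (corner q t')) (sideStart-opposite (flip q s) C q T[t₀] T[corner])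
                    (Reach-trans p (Reach-sideStart (flip q s) q t))
      where
      T[corner] : T (corner q t) ≡ false
      T[corner] = trans (sym (Stable-Reach {T = T} stable p)) T[z]


  -- Flips q₀ and q, only once when q = q₀, matching {j, j} = {j} in the exchange axiom.
  flip₂ : Fin k → Fin k → Choice → Choice
  flip₂ q₀ q s i = s i xor (does (i ≟ q₀) ∨ does (i ≟ q))

  flip₂-diagonal : ∀ q s i → flip q s i ≡ flip₂ q q s i
  flip₂-diagonal q s i = cong (s i xor_) (sym (∨-idem (does (i ≟ q))))

  flip-flip : ∀ {q₀ q} s → q ≢ q₀ → ∀ i → flip q (flip q₀ s) i ≡ flip₂ q₀ q s i
  flip-flip {q₀} {q} s q≢q₀ i =
    trans (xor-assoc (s i) (does (i ≟ q₀)) (does (i ≟ q))) (cong (s i xor_) (xor-disjoint (does (i ≟ q₀)) (does (i ≟ q)) not-both))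
    where
    not-both : ¬ (does (i ≟ q₀) ≡ true × does (i ≟ q) ≡ true)
    not-both (i≡q₀ , i≡q) = q≢q₀ (trans (sym (does≡true⇒ (i ≟ q) i≡q)) (does≡true⇒ (i ≟ q₀) i≡q₀))
    xor-disjoint : ∀ a b → ¬ (a ≡ true × b ≡ true) → a xor b ≡ a ∨ b
    xor-disjoint true true not-both = ⊥-elim (not-both (refl , refl))
    xor-disjoint true false _ = refl
    xor-disjoint false b _ = refl

  module _ (s₁ s₂ : Choice) (connected₁ : ConnectedBy G (twoFactor s₁)) (connected₂ : ConnectedBy G (twoFactor s₂))
           (q₀ : Fin k) (differ : s₁ q₀ ≢ s₂ q₀) where
    private
      s₁' = flip q₀ s₁
      v₀ = corner q₀ 0F
      C = component (twoFactor s₁') v₀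
      open Component C renaming (member to T)

    exchange-across : ∀ {w} → T w ≡ false → ∃[ q ] s₁ q ≢ s₂ q × ConnectedBy G (twoFactor (flip₂ q₀ q s₁))
    exchange-across {w} T[w]
      with Reach⇒Crossing {T = T} (connected₂ v₀ w) (λ eq → contradiction (trans (trans (sym root) eq) T[w]) λ ())
    ... | e , e∈₂ , crossing with crossing-side s₁' C crossing
    ... | q , t , refl with s₁' q ≟ᵇ s₂ q
    ...   | yes same = ⊥-elim (crossing (stable (side∈twoFactor-transfer (sym same) e∈₂)))
    ...   | no s₁'≢s₂ with side-straddles T crossing
    ...     | (t₁ , T[t₁]) , (t₂ , T[t₂]) with flip-merges s₁' C q T[t₁] T[t₂]
    ...       | B₀ , T[B₀] , merged = q , differs ,
      subst (ConnectedBy G) (twoFactor-cong (flip-flip s₁ q≢q₀)) (ConnectedBy-from v₀ (λ x → merged (inside-or-beyond x)))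
      where
      q≢q₀ : q ≢ q₀
      q≢q₀ refl = s₁'≢s₂ (trans (flip-≡ q₀ s₁) (trans (cong not (¬-not differ)) (not-involutive (s₂ q₀))))
      differs : s₁ q ≢ s₂ q
      differs same = s₁'≢s₂ (trans (flip-≢ s₁ q≢q₀) same)
      inside-or-beyond : ∀ x → T x ≡ true ⊎ Reach G (twoFactor s₁') B₀ x
      inside-or-beyond x with T x in T[x]
      ... | true = inj₁ refl
      ... | false = inj₂ (flip-splits-in-two s₁ connected₁ q₀ C T[B₀] T[x])

    exchange : ∃[ q ] s₁ q ≢ s₂ q × ConnectedBy G (twoFactor (flip₂ q₀ q s₁))
    exchange with all? (λ x → T x ≟ᵇ true)
    ... | yes all = q₀ , differ ,
      subst (ConnectedBy G) (twoFactor-cong (flip₂-diagonal q₀ s₁)) (ConnectedBy-from v₀ (λ x → reachable (all x)))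
    ... | no ¬all with ¬∀⟶∃¬ n _ (λ x → T x ≟ᵇ true) ¬all
    ... | w , T[w]≢true = exchange-across (¬-not T[w]≢true)

  module Traces (R : EdgeSet G) (R∩M≡∅ : ∀ e → e ∈ R → e ∉ M)
                (one-per-square : ∀ i → ∃[ j ] (side i j ∈ R × (∀ j' → side i j' ∈ R → j' ≡ j))) where

    repIndex : Fin k → Fin 4
    repIndex i = proj₁ (one-per-square i)

    rep : Fin k → Fin m
    rep i = side i (repIndex i)

    rep∈R : ∀ i → rep i ∈ R
    rep∈R i = proj₁ (proj₂ (one-per-square i))

    R⇒rep : ∀ {e} → e ∈ R → ∃[ i ] e ≡ rep i
    R⇒rep {e} e∈R with ∉M⇒side (R∩M≡∅ e e∈R)
    ... | i , t , refl with proj₂ (proj₂ (one-per-square i)) t e∈R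
    ... | refl = i , refl

    does-rep-≟ : ∀ i i' → does (rep i ≟ rep i') ≡ does (i ≟ i')
    does-rep-≟ i i' with rep i ≟ rep i' | i ≟ i'
    ... | yes _ | yes _ = refl
    ... | no _ | no _ = refl
    ... | yes eq | no i≢i' = ⊥-elim (i≢i' (proj₁ (side-injective eq)))
    ... | no rep≢ | yes refl = ⊥-elim (rep≢ refl)

    trace : Choice → EdgeSet G
    trace s = twoFactor s ∩ R

    lookup-trace : ∀ s e → lookup (trace s) e ≡ lookup (twoFactor s) e ∧ lookup R e
    lookup-trace s e = lookup-zipWith _∧_ e (twoFactor s) R

    lookup-trace-rep : ∀ s i → lookup (trace s) (rep i) ≡ does (odd (repIndex i) ≟ᵇ s i)
    lookup-trace-rep s i = begin
      lookup (trace s) (rep i)                               ≡⟨ lookup-trace s (rep i) ⟩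
      lookup (twoFactor s) (rep i) ∧ lookup R (rep i)        ≡⟨ cong₂ _∧_ (lookup-twoFactor-side s i (repIndex i)) ([]=⇒lookup (rep∈R i)) ⟩
      does (odd (repIndex i) ≟ᵇ s i) ∧ true                  ≡⟨ ∧-identityʳ _ ⟩
      does (odd (repIndex i) ≟ᵇ s i)                         ∎
      where open ≡-Reasoning

    lookup-trace-∉R : ∀ s {e} → e ∉ R → lookup (trace s) e ≡ false
    lookup-trace-∉R s {e} e∉R = trans (lookup-trace s e) (trans (cong (lookup (twoFactor s) e ∧_) (∉⇒lookup≡false e∉R)) (∧-zeroʳ _))

    lookup-△ : ∀ (X Y : EdgeSet G) e → lookup (X △ Y) e ≡ lookup X e xor lookup Y e
    lookup-△ X Y e = lookup-zipWith _xor_ e X Y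

    ∈trace△trace : ∀ s₁ s₂ {e} → e ∈ trace s₁ △ trace s₂ → ∃[ q ] e ≡ rep q × s₁ q ≢ s₂ q
    ∈trace△trace s₁ s₂ {e} e∈ with e ∈? R
    ... | no e∉R = ⊥-elim (e∉R (lookup⇒[]= e R (xor-∧-true {lookup (twoFactor s₁) e} {lookup (twoFactor s₂) e} (begin
      (lookup (twoFactor s₁) e ∧ lookup R e) xor (lookup (twoFactor s₂) e ∧ lookup R e)
        ≡⟨ cong₂ _xor_ (lookup-trace s₁ e) (lookup-trace s₂ e) ⟨
      lookup (trace s₁) e xor lookup (trace s₂) e
        ≡⟨ lookup-△ (trace s₁) (trace s₂) e ⟨
      lookup (trace s₁ △ trace s₂) e
        ≡⟨ []=⇒lookup e∈ ⟩
      true ∎))))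
      where
      open ≡-Reasoning
      xor-∧-true : ∀ {a b r} → (a ∧ r) xor (b ∧ r) ≡ true → r ≡ true
      xor-∧-true {r = true} _ = refl
      xor-∧-true {true} {true} {false} ()
      xor-∧-true {true} {false} {false} ()
      xor-∧-true {false} {true} {false} ()
      xor-∧-true {false} {false} {false} ()
    ... | yes e∈R with R⇒rep e∈R
    ... | q , refl = q , refl , λ same → contradiction (begin
      true                                                   ≡⟨ []=⇒lookup e∈ ⟨
      lookup (trace s₁ △ trace s₂) (rep q)                   ≡⟨ lookup-△ (trace s₁) (trace s₂) (rep q) ⟩
      lookup (trace s₁) (rep q) xor lookup (trace s₂) (rep q) ≡⟨ cong (_xor lookup (trace s₂) (rep q)) (trans (lookup-trace-rep s₁ q) (cong (λ b → does (odd (repIndex q) ≟ᵇ b)) same)) ⟩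
      does (odd (repIndex q) ≟ᵇ s₂ q) xor lookup (trace s₂) (rep q) ≡⟨ cong (does (odd (repIndex q) ≟ᵇ s₂ q) xor_) (lookup-trace-rep s₂ q) ⟩
      does (odd (repIndex q) ≟ᵇ s₂ q) xor does (odd (repIndex q) ≟ᵇ s₂ q) ≡⟨ xor-same (does (odd (repIndex q) ≟ᵇ s₂ q)) ⟩
      false                                                  ∎) λ ()
      where open ≡-Reasoning

    rep∈trace△trace : ∀ s₁ s₂ {q} → s₁ q ≢ s₂ q → rep q ∈ trace s₁ △ trace s₂
    rep∈trace△trace s₁ s₂ {q} differ = lookup⇒[]= (rep q) (trace s₁ △ trace s₂) (begin
      lookup (trace s₁ △ trace s₂) (rep q)                                 ≡⟨ lookup-△ (trace s₁) (trace s₂) (rep q) ⟩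
      lookup (trace s₁) (rep q) xor lookup (trace s₂) (rep q)              ≡⟨ cong₂ _xor_ (lookup-trace-rep s₁ q) (lookup-trace-rep s₂ q) ⟩
      does (odd (repIndex q) ≟ᵇ s₁ q) xor does (odd (repIndex q) ≟ᵇ s₂ q) ≡⟨ does-≟ᵇ-xor-≢ (odd (repIndex q)) differ ⟩
      true                                                                 ∎)
      where open ≡-Reasoning

    trace-flip₂ : ∀ s q₀ q → trace s △ (⁅ rep q₀ ⁆ ∪ ⁅ rep q ⁆) ≡ trace (flip₂ q₀ q s)
    trace-flip₂ s q₀ q = Subset-ext pointwise
      where
      open ≡-Reasoning
      flipped = ⁅ rep q₀ ⁆ ∪ ⁅ rep q ⁆
      lookup-flipped : ∀ e → lookup flipped e ≡ does (e ≟ rep q₀) ∨ does (e ≟ rep q)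
      lookup-flipped e = trans (lookup-zipWith _∨_ e ⁅ rep q₀ ⁆ ⁅ rep q ⁆) (cong₂ _∨_ (lookup-⁅⁆ (rep q₀) e) (lookup-⁅⁆ (rep q) e))
      pointwise : ∀ e → lookup (trace s △ flipped) e ≡ lookup (trace (flip₂ q₀ q s)) e
      pointwise e with e ∈? R
      ... | no e∉R = begin
        lookup (trace s △ flipped) e                        ≡⟨ lookup-△ (trace s) flipped e ⟩
        lookup (trace s) e xor lookup flipped e              ≡⟨ cong₂ _xor_ (lookup-trace-∉R s e∉R) (lookup-flipped e) ⟩
        does (e ≟ rep q₀) ∨ does (e ≟ rep q)                 ≡⟨ cong₂ _∨_ (dec-false (e ≟ rep q₀) (not-rep q₀)) (dec-false (e ≟ rep q) (not-rep q)) ⟩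
        false                                                ≡⟨ lookup-trace-∉R (flip₂ q₀ q s) e∉R ⟨
        lookup (trace (flip₂ q₀ q s)) e                      ∎
        where
        not-rep : ∀ i → e ≢ rep i
        not-rep i refl = e∉R (rep∈R i)
      ... | yes e∈R with R⇒rep e∈R
      ... | i , refl = begin
        lookup (trace s △ flipped) (rep i)                               ≡⟨ lookup-△ (trace s) flipped (rep i) ⟩
        lookup (trace s) (rep i) xor lookup flipped (rep i)              ≡⟨ cong₂ _xor_ (lookup-trace-rep s i) (trans (lookup-flipped (rep i)) (cong₂ _∨_ (does-rep-≟ i q₀) (does-rep-≟ i q))) ⟩
        does (odd (repIndex i) ≟ᵇ s i) xor (does (i ≟ q₀) ∨ does (i ≟ q)) ≡⟨ does-≟ᵇ-xor (odd (repIndex i)) (s i) (does (i ≟ q₀) ∨ does (i ≟ q)) ⟩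
        does (odd (repIndex i) ≟ᵇ flip₂ q₀ q s i)                        ≡⟨ lookup-trace-rep (flip₂ q₀ q s) i ⟨
        lookup (trace (flip₂ q₀ q s)) (rep i)                            ∎

    IsTrace : EdgeSet G → Set
    IsTrace X = ∃[ H ] (HamiltonianCycle G H × M ⊆ H × X ≡ H ∩ R)

    trace-IsTrace : ∀ {s} → ConnectedBy G (twoFactor s) → IsTrace (trace s)
    trace-IsTrace {s} connected = twoFactor s , (twoFactor-2-regular s , connected) , M⊆twoFactor s , refl

    IsTrace⇒trace : ∀ {X} → IsTrace X → ∃[ s ] ConnectedBy G (twoFactor s) × X ≡ trace s
    IsTrace⇒trace (H , (deg≡2 , connected) , M⊆H , refl) with 2-regular⇒twoFactor deg≡2 M⊆H
    ... | s , refl = s , connected , refl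

    traces-form-delta-matroid : IsDeltaMatroid R IsTrace
    traces-form-delta-matroid = (λ { X (H , _ , _ , refl) → p∩q⊆q H R })
                              , (trace s₀ , trace-IsTrace connected₀)
                              , exchange-axiom
      where
      s₀ = proj₁ hamiltonian-exists
      connected₀ = proj₂ hamiltonian-exists
      exchange-axiom : ∀ D₁ D₂ → IsTrace D₁ → IsTrace D₂ → ∀ j → j ∈ D₁ △ D₂ →
        ∃[ k' ] (k' ∈ D₁ △ D₂ × IsTrace (D₁ △ (⁅ j ⁆ ∪ ⁅ k' ⁆)))
      exchange-axiom D₁ D₂ D₁-trace D₂-trace j j∈ with IsTrace⇒trace D₁-trace | IsTrace⇒trace D₂-trace
      ... | s₁ , connected₁ , refl | s₂ , connected₂ , refl with ∈trace△trace s₁ s₂ j∈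
      ... | q₀ , refl , differ with exchange s₁ s₂ connected₁ connected₂ q₀ differ
      ... | q , differ-q , connected = rep q , rep∈trace△trace s₁ s₂ differ-q ,
        subst IsTrace (sym (trace-flip₂ s₁ q₀ q)) (trace-IsTrace connected)

theorem11 : (G : Graph) (M : EdgeSet G) (SG : SquareGraph G M)
    → (R : EdgeSet G)
    → (∀ e → e ∈ R → e ∉ M)
    → (∀ i → ∃[ j ] (Square.es (SquareGraph.square SG i) j ∈ R
                      × (∀ j' → Square.es (SquareGraph.square SG i) j' ∈ R → j' ≡ j)))
    → (∃[ H ] (HamiltonianCycle G H × M ⊆ H))
      × IsDeltaMatroid R (λ X → ∃[ H ] (HamiltonianCycle G H × M ⊆ H × X ≡ H ∩ R))
theorem11 G M SG R R∩M≡∅ one-per-square =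
  (twoFactor s₀ , (twoFactor-2-regular s₀ , connected₀) , M⊆twoFactor s₀) , traces-form-delta-matroid
  where
  open SquareGraphs G M SG
  open Traces R R∩M≡∅ one-per-square
  s₀ = proj₁ hamiltonian-exists
  connected₀ = proj₂ hamiltonian-exists
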